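{- Let $G$ be a graph and $t\ge1$ an integer. If $\varphi(G)\ge t$, then $G$ contains an induced subgraph isomorphic to a minimal b-$t$-atom.
   Context: A proper $k$-coloring of $G$ is a surjective map $c:V(G)\to\{1,\dots,k\}$ with $c(u)\ne c(v)$ for every edge $uv$. In a proper $k$-coloring, a vertex $v$ of color $i$ is a b-vertex if for every $j\ne i$ in $\{1,\dots,k\}$, $v$ has a neighbor of color $j$. A b-$k$-coloring is a proper $k$-coloring in which every color class contains a b-vertex; $\varphi(G)$ is the largest $k$ such that $G$ has a b-$k$-coloring. A b-$t$-atom is a graph $A$ whose vertex set can be partitioned into $t$ sets $D_1,\dots,D_t$, where each $D_i$ contains a special vertex $c_i$, such that each $D_i$ is an independent set with $|D_i|\le t$, and for all $i\ne j$, $c_i$ has a neighbor in $D_j$. A b-$t$-atom is minimal if no b-$t$-atom is a proper induced subgraph of it. -}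

module Defs where

open import Data.Nat using (ℕ; _≤_)
open import Data.Fin using (Fin; _≟_)
open import Data.Bool using (Bool; true; false)
open import Data.List using (length; filter)
open import Data.List.Base using ()
open import Data.Fin.Base using ()
open import Data.List using (List)
open import Data.Product using (Σ; ∃; _×_; _,_)
open import Relation.Binary.PropositionalEquality using (_≡_; _≢_)
open import Relation.Nullary using (¬_)
open import Function.Definitions using (Injective)
import Data.List as L
open import Data.Fin.Base using () renaming (toℕ to toℕ)

allFin' : (n : ℕ) → List (Fin n)
allFin' n = L.allFin n

record Graph : Set where
  field
    n      : ℕ
    adj    : Fin n → Fin n → Bool
    sym    : ∀ u v → adj u v ≡ adj v u
    irrefl : ∀ v → adj v v ≡ false

  V : Set
  V = Fin n

  Edge : V → V → Set
  Edge u v = adj u v ≡ true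

open Graph public

record ProperColoring (G : Graph) (k : ℕ) : Set where
  field
    col    : V G → Fin k
    surj   : ∀ (j : Fin k) → ∃ λ v → col v ≡ j
    proper : ∀ u v → Edge G u v → col u ≢ col v

open ProperColoring public

IsBVertex : {G : Graph} {k : ℕ} → ProperColoring G k → V G → Set
IsBVertex {G} c v = ∀ j → j ≢ col c v → ∃ λ u → Edge G v u × col c u ≡ j

record BColoring (G : Graph) (k : ℕ) : Set where
  field
    coloring : ProperColoring G k
    bvert    : ∀ (i : Fin k) → ∃ λ v → col coloring v ≡ i × IsBVertex coloring v

-- φ(G) ≥ t  ⇔  G has a b-k-coloring for some k ≥ t  (φ(G) is the largest such k).
PhiAtLeast : Graph → ℕ → Set
PhiAtLeast G t = ∃ λ k → t ≤ k × BColoring G k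

classSize : (G : Graph) {t : ℕ} → (V G → Fin t) → Fin t → ℕ
classSize G d i = length (filter (λ v → d v ≟ i) (allFin' (n G)))

record BAtom (t : ℕ) (A : Graph) : Set where
  field
    part        : V A → Fin t
    centre      : Fin t → V A
    centreIn    : ∀ i → part (centre i) ≡ i
    independent : ∀ u v → Edge A u v → part u ≢ part v
    smallClass  : ∀ i → classSize A part i ≤ t
    dominating  : ∀ i j → i ≢ j → ∃ λ u → Edge A (centre i) u × part u ≡ j

-- Induced-subgraph embedding of H into G: an injective vertex map preserving adjacency and
-- non-adjacency; H is then isomorphic to the induced subgraph of G on the image.
record InducedEmbedding (H G : Graph) : Set where
  field
    emb       : V H → V G
    injective : Injective _≡_ _≡_ emb
    preserves : ∀ u v → adj G (emb u) (emb v) ≡ adj H u v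

open InducedEmbedding public

IsProper : {H G : Graph} → InducedEmbedding H G → Set
IsProper {H} {G} e = ∃ λ (w : V G) → ∀ (u : V H) → emb e u ≢ w

record MinimalBAtom (t : ℕ) (A : Graph) : Set where
  field
    atom    : BAtom t A
    minimal : ∀ (B : Graph) → BAtom t B → (e : InducedEmbedding B A) → ¬ IsProper e

module Submission where

open import Defs hiding (sym)

open import Data.Bool using (Bool; true; false; T)
open import Data.Bool.Properties using () renaming (_≟_ to _≟ᵇ_)
open import Data.Empty using (⊥-elim)
open import Data.Fin using (Fin; zero; suc; _≟_; inject≤; punchOut)
open import Data.Fin.Properties using (any?; all?; inject≤-injective; injective⇒≤; punchOut-injective)
open import Data.List using (List; _∷_; length; filter; lookup; allFin)
open import Data.List.Membership.Propositional.Properties using (∈-lookup; ∈-filter⁺; ∈-filter⁻; ∈-allFin)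
open import Data.List.Properties using (filter-≐)
import Data.List.Relation.Unary.All as All
import Data.List.Relation.Unary.Any as Any
open import Data.List.Relation.Unary.Any.Properties using (lookup-index)
open import Data.List.Relation.Unary.AllPairs using (_∷_)
open import Data.List.Relation.Unary.Unique.Propositional using (Unique)
open import Data.List.Relation.Unary.Unique.Propositional.Properties using (filter⁺; allFin⁺)
open import Data.Nat using (ℕ; zero; suc; _≤_; _<_; _≤?_; _<?_; s≤s)
open import Data.Nat.Properties using (≤-refl; ≤-trans; ≤-pred; ≤-<-trans; <-≤-trans; ≮⇒≥; <⇒≱)
open import Data.Product using (Σ; ∃; _×_; _,_; proj₁; proj₂)
open import Data.Vec using (Vec; []; _∷_; tabulate) renaming (lookup to _!_)
open import Data.Vec.Properties using (lookup∘tabulate)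
open import Function using (_∘_)
open import Function.Definitions using (Injective)
open import Relation.Binary.PropositionalEquality
  using (_≡_; _≢_; _≗_; refl; sym; trans; cong; cong₂; subst; subst₂)
open import Relation.Nullary using (Dec; yes; no; ¬?)
open import Relation.Nullary.Decidable using (isYes; toWitness; fromWitness; map′; T?; _×-dec_; _→-dec_)
open import Relation.Unary using (Decidable; _≐_)

-- A b-colouring with at least t colours provides b-vertices c₁, …, cₜ of distinct colours and,
-- for i ≠ j, a neighbour of cᵢ of colour j; the colour classes restricted to these at most t²
-- vertices form a b-t-atom inside G. Atom structures on vertex subsets of G form a finite,
-- decidable family, so one with the fewest vertices exists. The subgraph it induces is a minimal
-- b-t-atom: a b-t-atom properly embedded in it is again an atom structure in G, with fewer vertices.

lookup-injective : ∀ {A : Set} {xs : List A} → Unique xs → Injective _≡_ _≡_ (lookup xs)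
lookup-injective (_ ∷ _)     {zero}  {zero}  _  = refl
lookup-injective (x∉ ∷ _)    {zero}  {suc j} eq = ⊥-elim (All.lookup x∉ (∈-lookup j) eq)
lookup-injective (x∉ ∷ _)    {suc i} {zero}  eq = ⊥-elim (All.lookup x∉ (∈-lookup i) (sym eq))
lookup-injective (_ ∷ uniq)  {suc i} {suc j} eq = cong suc (lookup-injective uniq eq)

module Enumeration {m : ℕ} {P : Fin m → Set} (P? : Decidable P) where

  members : List (Fin m)
  members = filter P? (allFin m)

  size : ℕ
  size = length members

  member : Fin size → Fin m
  member = lookup members

  member-injective : Injective _≡_ _≡_ member
  member-injective = lookup-injective (filter⁺ P? (allFin⁺ m))

  member-satisfies : ∀ i → P (member i)
  member-satisfies i = proj₂ (∈-filter⁻ P? {xs = allFin m} (∈-lookup i))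

  index : ∀ {w} → P w → Fin size
  index {w} pw = Any.index (∈-filter⁺ P? (∈-allFin w) pw)

  member-index : ∀ {w} (pw : P w) → member (index pw) ≡ w
  member-index {w} pw = sym (lookup-index (∈-filter⁺ P? (∈-allFin w) pw))

  index-injective : ∀ {u v} (pu : P u) (pv : P v) → index pu ≡ index pv → u ≡ v
  index-injective pu pv eq = trans (sym (member-index pu)) (trans (cong member eq) (member-index pv))

  size≤ : ∀ {k} (f : ∀ {w} → P w → Fin k) →
          (∀ {u v} (pu : P u) (pv : P v) → f pu ≡ f pv → u ≡ v) → size ≤ k
  size≤ f f-injective =
    injective⇒≤ {f = λ i → f (member-satisfies i)} (λ eq → member-injective (f-injective _ _ eq))

size-cong : ∀ {m} {P Q : Fin m → Set} (P? : Decidable P) (Q? : Decidable Q) →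
            P ≐ Q → Enumeration.size P? ≡ Enumeration.size Q?
size-cong P? Q? P≐Q = cong length (filter-≐ P? Q? P≐Q (allFin _))

injective-missing⇒< : ∀ {a b} {f : Fin a → Fin b} → Injective _≡_ _≡_ f →
                      (w : Fin b) → (∀ u → f u ≢ w) → a < b
injective-missing⇒< {b = suc _} {f} f-injective w missed =
  s≤s (injective⇒≤ {f = λ u → punchOut (w≢f u)}
                   (λ eq → f-injective (punchOut-injective (w≢f _) (w≢f _) eq)))
  where
  w≢f : ∀ u → w ≢ f u
  w≢f u eq = missed u (sym eq)

proper⇒< : ∀ {H G : Graph} (e : InducedEmbedding H G) → IsProper e → n H < n G
proper⇒< e (w , missed) = injective-missing⇒< (injective e) w missed

induced-trans : ∀ {A B C : Graph} → InducedEmbedding A B → InducedEmbedding B C → InducedEmbedding A C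
induced-trans e f = record
  { emb       = λ u → emb f (emb e u)
  ; injective = λ eq → injective e (injective f eq)
  ; preserves = λ u v → trans (preserves f _ _) (preserves e u v)
  }

anyBool? : ∀ {P : Bool → Set} → Decidable P → Dec (∃ P)
anyBool? P? with P? true | P? false
... | yes p | _     = yes (true , p)
... | no _  | yes p = yes (false , p)
... | no ¬t | no ¬f = no λ { (true , p) → ¬t p ; (false , p) → ¬f p }

anyVec? : ∀ {A : Set} → (∀ {Q : A → Set} → Decidable Q → Dec (∃ Q)) →
          ∀ m {P : Vec A m → Set} → Decidable P → Dec (∃ P)
anyVec? any-A? zero P? = map′ ([] ,_) (λ { ([] , p) → p }) (P? [])
anyVec? any-A? (suc m) P? =
  map′ (λ (x , xs , p) → x ∷ xs , p) (λ { (x ∷ xs , p) → x , xs , p })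
       (any-A? λ x → anyVec? any-A? m λ xs → P? (x ∷ xs))

minimise : ∀ {X : Set} (size : X → ℕ) → (∀ s → Dec (∃ λ x → size x < s)) →
           X → ∃ λ x → ∀ y → size x ≤ size y
minimise size smaller? x = descend (suc (size x)) x ≤-refl
  where
  descend : ∀ s x → size x < s → ∃ λ x → ∀ y → size x ≤ size y
  descend (suc s) x x<s with smaller? (size x)
  ... | yes (y , y<x) = descend s y (<-≤-trans y<x (≤-pred x<s))
  ... | no nothing-smaller = x , λ y → ≮⇒≥ λ y<x → nothing-smaller (y , y<x)

module Image {X : Set} {m : ℕ} (f : X → Fin m) (f? : ∀ w → Dec (∃ λ x → f x ≡ w)) where

  inImage : Fin m → Bool
  inImage w = isYes (f? w)

  preimage : ∀ {w} → T (inImage w) → X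
  preimage w∈ = proj₁ (toWitness w∈)

  f-preimage : ∀ {w} (w∈ : T (inImage w)) → f (preimage w∈) ≡ w
  f-preimage w∈ = proj₂ (toWitness w∈)

  preimage-injective : ∀ {u v} (u∈ : T (inImage u)) (v∈ : T (inImage v)) →
                       preimage u∈ ≡ preimage v∈ → u ≡ v
  preimage-injective u∈ v∈ eq = trans (sym (f-preimage u∈)) (trans (cong f eq) (f-preimage v∈))

  image : ∀ x → T (inImage (f x))
  image x = fromWitness (x , refl)

  label : ∀ {C : Set} → C → (X → C) → Fin m → C
  label d h w with f? w
  ... | yes (x , _) = h x
  ... | no _        = d

  label-preimage : ∀ {C : Set} (d : C) (h : X → C) {w} (w∈ : T (inImage w)) →
                   label d h w ≡ h (preimage w∈)
  label-preimage d h {w} w∈ with f? w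
  ... | yes _ = refl

supportSize : ∀ {m} → (Fin m → Bool) → ℕ
supportSize S = Enumeration.size (λ u → T? (S u))

supportedClassSize : ∀ {m t} → (Fin m → Bool) → (Fin m → Fin t) → Fin t → ℕ
supportedClassSize S class i = Enumeration.size (λ u → T? (S u) ×-dec (class u ≟ i))

-- The b-t-atom conditions for the subgraph of G induced by S; phrasing them inside G makes
-- atom structures a finite family that can be searched.
record IsAtomIn (G : Graph) (t : ℕ) (S : V G → Bool) (class : V G → Fin t) (centre : Fin t → V G) : Set where
  field
    centre-in    : ∀ i → T (S (centre i))
    centre-class : ∀ i → class (centre i) ≡ i
    independent  : ∀ {u v} → T (S u) → T (S v) → Edge G u v → class u ≢ class v
    smallClass   : ∀ i → supportedClassSize S class i ≤ t
    dominating   : ∀ i j → i ≢ j → ∃ λ u → T (S u) × Edge G (centre i) u × class u ≡ j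

isAtomIn? : ∀ G t S class centre → Dec (IsAtomIn G t S class centre)
isAtomIn? G t S class centre = map′
  (λ (c-in , c-class , indep , small , dom) → record
    { centre-in = c-in ; centre-class = c-class ; independent = λ {u} {v} → indep u v
    ; smallClass = small ; dominating = dom })
  (λ isAtom → let open IsAtomIn isAtom in
    centre-in , centre-class , (λ u v → independent) , smallClass , dominating)
  (all? (λ i → T? (S (centre i))) ×-dec
   all? (λ i → class (centre i) ≟ i) ×-dec
   all? (λ u → all? λ v → T? (S u) →-dec T? (S v) →-dec (adj G u v ≟ᵇ true) →-dec ¬? (class u ≟ class v)) ×-dec
   all? (λ i → supportedClassSize S class i ≤? t) ×-dec
   all? (λ i → all? λ j → ¬? (i ≟ j) →-dec
     any? λ u → T? (S u) ×-dec (adj G (centre i) u ≟ᵇ true) ×-dec (class u ≟ j)))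

IsAtomIn-cong : ∀ {G t S S′ class class′ centre centre′} →
                S ≗ S′ → class ≗ class′ → centre ≗ centre′ →
                IsAtomIn G t S class centre → IsAtomIn G t S′ class′ centre′
IsAtomIn-cong {G} {S = S} {S′} {class} {class′} S≗ class≗ centre≗ isAtom = record
  { centre-in    = λ i → subst T (S≗ _) (subst (T ∘ S) (centre≗ i) (centre-in i))
  ; centre-class = λ i → trans (sym (class≗ _)) (trans (cong class (sym (centre≗ i))) (centre-class i))
  ; independent  = λ u∈ v∈ e eq →
      independent (in← u∈) (in← v∈) e (trans (class≗ _) (trans eq (sym (class≗ _))))
  ; smallClass   = λ i → subst (_≤ _) (supportedClassSize-cong i) (smallClass i)
  ; dominating   = λ i j i≢j → let (u , u∈ , e , cu) = dominating i j i≢j in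
      u , subst T (S≗ u) u∈ , subst (λ c → Edge G c u) (centre≗ i) e , trans (sym (class≗ u)) cu
  }
  where
  open IsAtomIn isAtom
  in← : ∀ {u} → T (S′ u) → T (S u)
  in← {u} = subst T (sym (S≗ u))
  supportedClassSize-cong : ∀ i → supportedClassSize S class i ≡ supportedClassSize S′ class′ i
  supportedClassSize-cong i =
    size-cong (λ u → T? (S u) ×-dec (class u ≟ i)) (λ u → T? (S′ u) ×-dec (class′ u ≟ i))
    ( (λ {u} (u∈ , cu) → subst T (S≗ u) u∈ , trans (sym (class≗ u)) cu)
    , (λ {u} (u∈ , cu) → in← u∈ , trans (class≗ u) cu) )

record AtomIn (G : Graph) (t : ℕ) : Set where
  field
    support : V G → Bool
    class   : V G → Fin t
    centre  : Fin t → V G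
    isAtom  : IsAtomIn G t support class centre

size : ∀ {G t} → AtomIn G t → ℕ
size a = supportSize (AtomIn.support a)

smallerAtomIn? : ∀ G t s → Dec (∃ λ (a : AtomIn G t) → size a < s)
smallerAtomIn? G t s = map′
  (λ (S , class , centre , isAtom , small) →
    record { support = S !_ ; class = class !_ ; centre = centre !_ ; isAtom = isAtom } , small)
  (λ (a , small) → let open AtomIn a in
    tabulate support , tabulate class , tabulate centre ,
    IsAtomIn-cong (sym ∘ lookup∘tabulate support) (sym ∘ lookup∘tabulate class)
                  (sym ∘ lookup∘tabulate centre) isAtom ,
    subst (_< s) (size-cong (T? ∘ support) (T? ∘ (tabulate support !_))
                            (T-cong (sym ∘ lookup∘tabulate support))) small)
  (anyVec? anyBool? (n G) λ S → anyVec? any? (n G) λ class → anyVec? any? t λ centre →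
    isAtomIn? G t (S !_) (class !_) (centre !_) ×-dec supportSize (S !_) <? s)
  where
  T-cong : ∀ {S S′ : V G → Bool} → S ≗ S′ → (T ∘ S) ≐ (T ∘ S′)
  T-cong S≗ = (λ {u} → subst T (S≗ u)) , (λ {u} → subst T (sym (S≗ u)))

module Induced {G : Graph} {t : ℕ} (a : AtomIn G t) where
  open AtomIn a
  open IsAtomIn isAtom
  module Support = Enumeration (λ u → T? (support u))
  open Support using (member; member-injective; member-satisfies; index; member-index)

  graph : Graph
  graph = record
    { n      = Support.size
    ; adj    = λ u v → adj G (member u) (member v)
    ; sym    = λ u v → Graph.sym G (member u) (member v)
    ; irrefl = λ v → irrefl G (member v)
    }

  embedding : InducedEmbedding graph G
  embedding = record { emb = member ; injective = member-injective ; preserves = λ _ _ → refl }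

  part : V graph → Fin t
  part v = class (member v)

  part-smallClass : ∀ i → classSize graph part i ≤ t
  part-smallClass i = ≤-trans
    (Enumeration.size≤ (λ v → part v ≟ i) (λ {v} p≡i → Class.index (member-satisfies v , p≡i))
                       (λ _ _ eq → member-injective (Class.index-injective _ _ eq)))
    (smallClass i)
    where module Class = Enumeration (λ u → T? (support u) ×-dec (class u ≟ i))

  atom : BAtom t graph
  atom = record
    { part        = part
    ; centre      = λ i → index (centre-in i)
    ; centreIn    = λ i → trans (cong class (member-index _)) (centre-class i)
    ; independent = λ u v → independent (member-satisfies u) (member-satisfies v)
    ; smallClass  = part-smallClass
    ; dominating  = λ i j i≢j → let (u , u∈ , e , cu) = dominating i j i≢j in
        index u∈ , subst₂ (Edge G) (sym (member-index _)) (sym (member-index u∈)) e ,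
        trans (cong class (member-index u∈)) cu
    }

module EmbeddedAtom {G B : Graph} {t : ℕ} (β : BAtom (suc t) B) (e : InducedEmbedding B G) where
  open BAtom β
  open Image (emb e) (λ w → any? λ v → emb e v ≟ w)

  class : V G → Fin (suc t)
  class = label zero part

  class-preimage : ∀ {u} (u∈ : T (inImage u)) → class u ≡ part (preimage u∈)
  class-preimage = label-preimage zero part

  class-emb : ∀ v → class (emb e v) ≡ part v
  class-emb v = trans (class-preimage (image v)) (cong part (injective e (f-preimage (image v))))

  edge-preimage : ∀ {u v} (u∈ : T (inImage u)) (v∈ : T (inImage v)) →
                  Edge G u v → Edge B (preimage u∈) (preimage v∈)
  edge-preimage u∈ v∈ uv =
    trans (sym (preserves e _ _)) (subst₂ (Edge G) (sym (f-preimage u∈)) (sym (f-preimage v∈)) uv)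

  class-smallClass : ∀ i → supportedClassSize inImage class i ≤ suc t
  class-smallClass i = ≤-trans
    (Enumeration.size≤ (λ u → T? (inImage u) ×-dec (class u ≟ i))
                       (λ (u∈ , cu) → Class.index (trans (sym (class-preimage u∈)) cu))
                       (λ (u∈ , _) (v∈ , _) eq → preimage-injective u∈ v∈ (Class.index-injective _ _ eq)))
    (smallClass i)
    where module Class = Enumeration (λ v → part v ≟ i)

  atomIn : AtomIn G (suc t)
  atomIn = record
    { support = inImage
    ; class   = class
    ; centre  = λ i → emb e (centre i)
    ; isAtom  = record
      { centre-in    = λ i → image (centre i)
      ; centre-class = λ i → trans (class-emb (centre i)) (centreIn i)
      ; independent  = λ u∈ v∈ uv cu≡cv → independent _ _ (edge-preimage u∈ v∈ uv)
          (trans (sym (class-preimage u∈)) (trans cu≡cv (class-preimage v∈)))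
      ; smallClass   = class-smallClass
      ; dominating   = λ i j i≢j → let (u , cu , cu≡j) = dominating i j i≢j in
          emb e u , image u , trans (preserves e _ _) cu , trans (class-emb u) cu≡j
      }
    }

  size-atomIn : size atomIn ≤ n B
  size-atomIn = Enumeration.size≤ (T? ∘ inImage) preimage preimage-injective

module BColoringAtom {G : Graph} {t k : ℕ} (t≤k : suc t ≤ k) (β : BColoring G k) where
  open BColoring β

  ι : Fin (suc t) → Fin k
  ι i = inject≤ i t≤k

  ι-injective : Injective _≡_ _≡_ ι
  ι-injective = inject≤-injective t≤k t≤k _ _

  bVertex : Fin (suc t) → V G
  bVertex i = proj₁ (bvert (ι i))

  bVertex-col : ∀ i → col coloring (bVertex i) ≡ ι i
  bVertex-col i = proj₁ (proj₂ (bvert (ι i)))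

  neighbour : ∀ i j → i ≢ j → ∃ λ u → Edge G (bVertex i) u × col coloring u ≡ ι j
  neighbour i j i≢j = proj₂ (proj₂ (bvert (ι i))) (ι j)
    λ ιj≡ → i≢j (sym (ι-injective (trans ιj≡ (bVertex-col i))))

  representative : Fin (suc t) → Fin (suc t) → V G
  representative i j with i ≟ j
  ... | yes _   = bVertex j
  ... | no i≢j  = proj₁ (neighbour i j i≢j)

  representative-col : ∀ i j → col coloring (representative i j) ≡ ι j
  representative-col i j with i ≟ j
  ... | yes _   = bVertex-col j
  ... | no i≢j  = proj₂ (proj₂ (neighbour i j i≢j))

  representative-diagonal : ∀ i → representative i i ≡ bVertex i
  representative-diagonal i with i ≟ i
  ... | yes _   = refl
  ... | no i≢i  = ⊥-elim (i≢i refl)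

  representative-adjacent : ∀ {i j} → i ≢ j → Edge G (representative i i) (representative i j)
  representative-adjacent {i} {j} i≢j rewrite representative-diagonal i with i ≟ j
  ... | yes i≡j = ⊥-elim (i≢j i≡j)
  ... | no i≢j′ = proj₁ (proj₂ (neighbour i j i≢j′))

  open Image (λ (i , j) → representative i j)
             (λ w → map′ (λ (i , j , eq) → (i , j) , eq) (λ ((i , j) , eq) → i , j , eq)
                         (any? λ i → any? λ j → representative i j ≟ w))

  class : V G → Fin (suc t)
  class = label zero proj₂

  col-class : ∀ {u} (u∈ : T (inImage u)) → col coloring u ≡ ι (class u)
  col-class u∈ = trans (sym (cong (col coloring) (f-preimage u∈)))
    (trans (representative-col (proj₁ (preimage u∈)) _) (cong ι (sym (label-preimage zero proj₂ u∈))))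

  class-representative : ∀ i j → class (representative i j) ≡ j
  class-representative i j =
    ι-injective (trans (sym (col-class (image (i , j)))) (representative-col i j))

  class-smallClass : ∀ j → supportedClassSize inImage class j ≤ suc t
  class-smallClass j = Enumeration.size≤ (λ u → T? (inImage u) ×-dec (class u ≟ j))
    (λ (u∈ , _) → proj₁ (preimage u∈))
    (λ (u∈ , cu) (v∈ , cv) eq → preimage-injective u∈ v∈
      (cong₂ _,_ eq (trans (sym (label-preimage zero proj₂ u∈))
                           (trans cu (trans (sym cv) (label-preimage zero proj₂ v∈))))))

  atomIn : AtomIn G (suc t)
  atomIn = record
    { support = inImage
    ; class   = class
    ; centre  = λ i → representative i i
    ; isAtom  = record
      { centre-in    = λ i → image (i , i)
      ; centre-class = λ i → class-representative i i
      ; independent  = λ u∈ v∈ uv cu≡cv → proper coloring _ _ uv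
          (trans (col-class u∈) (trans (cong ι cu≡cv) (sym (col-class v∈))))
      ; smallClass   = class-smallClass
      ; dominating   = λ i j i≢j → representative i j , image (i , j) ,
          representative-adjacent i≢j , class-representative i j
      }
    }

inducedMinimal : ∀ {G t} (a : AtomIn G (suc t)) → (∀ b → size a ≤ size b) →
                 MinimalBAtom (suc t) (Induced.graph a)
inducedMinimal a least = record
  { atom    = Induced.atom a
  ; minimal = λ B β e proper →
      let open EmbeddedAtom β (induced-trans e (Induced.embedding a)) in
      <⇒≱ (≤-<-trans size-atomIn (proper⇒< e proper)) (least atomIn)
  }

mainTheorem11 : (G : Graph) (t : ℕ) → 1 ≤ t → PhiAtLeast G t →
    Σ Graph λ A → MinimalBAtom t A × InducedEmbedding A G
mainTheorem11 G (suc t) _ (k , t≤k , β) =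
  let (a , least) = minimise size (smallerAtomIn? G (suc t)) (BColoringAtom.atomIn t≤k β)
  in Induced.graph a , inducedMinimal a least , Induced.embedding a
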